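{- Let $G$ be a finite simple graph (undirected, no loops, no multiple edges) with $V \geq 2$ vertices and $E$ edges, and let $T$ be the number of triangles of $G$. Then $$T \leq \frac{V-2}{\sqrt{V(V-1)}}\cdot\frac{\sqrt{2}}{3}\, E^{3/2}.$$
   Context: A triangle of $G$ is a set of three pairwise adjacent vertices. -}

module Defs where

open import Data.Nat using (ℕ; _+_; _<ᵇ_)
open import Data.Bool using (Bool; true; false; _∧_; if_then_else_)
open import Data.Fin using (Fin; toℕ; zero; suc)
open import Relation.Binary.PropositionalEquality using (_≡_)

record SimpleGraph (n : ℕ) : Set where
  field
    Adj       : Fin n → Fin n → Bool
    symmetric : ∀ i j → Adj i j ≡ Adj j i
    loopless  : ∀ i → Adj i i ≡ false

open SimpleGraph public

Σᶠ : ∀ {n} → (Fin n → ℕ) → ℕ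
Σᶠ {ℕ.zero}  f = 0
Σᶠ {ℕ.suc n} f = f zero + Σᶠ {n} (λ i → f (suc i))

𝟙 : Bool → ℕ
𝟙 true  = 1
𝟙 false = 0

_<ᶠ_ : ∀ {n} → Fin n → Fin n → Bool
i <ᶠ j = toℕ i <ᵇ toℕ j

edgeCount : ∀ {n} → SimpleGraph n → ℕ
edgeCount G = Σᶠ λ i → Σᶠ λ j → 𝟙 ((i <ᶠ j) ∧ Adj G i j)

triangleCount : ∀ {n} → SimpleGraph n → ℕ
triangleCount G = Σᶠ λ i → Σᶠ λ j → Σᶠ λ k →
  𝟙 ((i <ᶠ j) ∧ (j <ᶠ k) ∧ Adj G i j ∧ Adj G j k ∧ Adj G i k)

{-# OPTIONS --safe #-}
-- Let n = m + 2, write d_v for the degree of v and P_v = closedWalks₃ v for the number of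
-- ordered pairs of adjacent neighbours of v, so that Σ P_v ≥ 6T and Σ d_v = 2E. Each
-- vertex satisfies P_v ≤ d_v (d_v - 1) and P_v + 2 d_v ≤ 2E, because the edges at v and
-- the edges inside its neighbourhood are distinct. As x²/(x + 2d) increases in x and
-- e²/((e + 1)(e + 2)) increases in e ≤ m, these give (m + 1)(m + 2) P_v² ≤ m² · 2E · d_v².
-- Summing the square roots of this over v gives the claim; the square roots are avoided by
-- summing the cross terms (m + 1)(m + 2) P_u P_v ≤ m² · 2E · d_u d_v over all pairs instead.
module Submission where

open import Defs
open import Data.Nat using (ℕ; zero; suc; _+_; _*_; _∸_; _^_; _≤_; _<_; z≤n; s≤s)
open import Data.Nat.Properties
open import Data.Nat.Tactic.RingSolver using (solve-∀; solve)
open import Data.List using (_∷_; [])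
open import Data.Bool using (Bool; true; false; _∧_; not)
open import Data.Bool.Properties using (∧-comm; ∧-assoc)
open import Data.Fin using (Fin; zero; suc)
open import Data.Sum using (_⊎_; inj₁; inj₂; map₂)
open import Data.Product using (_,_)
open import Relation.Binary.PropositionalEquality
open import Algebra.Properties.Semiring.Sum +-*-semiring
  using (sum; sum-cong-≗; ∑-distrib-+; ∑-comm; *-distribˡ-sum; *-distribʳ-sum)

Σᶠ≡sum : ∀ {n} (f : Fin n → ℕ) → Σᶠ f ≡ sum f
Σᶠ≡sum {zero}  f = refl
Σᶠ≡sum {suc n} f = cong (f zero +_) (Σᶠ≡sum (λ i → f (suc i)))

Σᶠ-cong : ∀ {n} {f g : Fin n → ℕ} → (∀ i → f i ≡ g i) → Σᶠ f ≡ Σᶠ g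
Σᶠ-cong {f = f} {g} f≗g = trans (Σᶠ≡sum f) (trans (sum-cong-≗ f≗g) (sym (Σᶠ≡sum g)))

Σᶠ-+ : ∀ {n} (f g : Fin n → ℕ) → Σᶠ (λ i → f i + g i) ≡ Σᶠ f + Σᶠ g
Σᶠ-+ f g = trans (Σᶠ≡sum (λ i → f i + g i))
  (trans (∑-distrib-+ f g) (sym (cong₂ _+_ (Σᶠ≡sum f) (Σᶠ≡sum g))))

Σᶠ-*ˡ : ∀ {n} c (f : Fin n → ℕ) → Σᶠ (λ i → c * f i) ≡ c * Σᶠ f
Σᶠ-*ˡ c f = trans (Σᶠ≡sum (λ i → c * f i))
  (sym (trans (cong (c *_) (Σᶠ≡sum f)) (*-distribˡ-sum c f)))

Σᶠ-*ʳ : ∀ {n} c (f : Fin n → ℕ) → Σᶠ (λ i → f i * c) ≡ Σᶠ f * c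
Σᶠ-*ʳ c f = trans (Σᶠ≡sum (λ i → f i * c))
  (sym (trans (cong (_* c) (Σᶠ≡sum f)) (*-distribʳ-sum c f)))

Σᶠ-comm : ∀ {m n} (f : Fin m → Fin n → ℕ) →
  Σᶠ (λ i → Σᶠ (λ j → f i j)) ≡ Σᶠ (λ j → Σᶠ (λ i → f i j))
Σᶠ-comm f = trans (Σᶠ²≡sum² f) (trans (∑-comm f) (sym (Σᶠ²≡sum² (λ j i → f i j))))
  where
  Σᶠ²≡sum² : ∀ {m n} (h : Fin m → Fin n → ℕ) →
    Σᶠ (λ i → Σᶠ (λ j → h i j)) ≡ sum (λ i → sum (λ j → h i j))
  Σᶠ²≡sum² h = trans (Σᶠ-cong (λ i → Σᶠ≡sum (h i))) (Σᶠ≡sum (λ i → sum (λ j → h i j)))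

Σᶠ-*-Σᶠ : ∀ {n} (f g : Fin n → ℕ) → Σᶠ f * Σᶠ g ≡ Σᶠ (λ u → Σᶠ (λ v → f u * g v))
Σᶠ-*-Σᶠ f g = trans (sym (Σᶠ-*ʳ (Σᶠ g) f)) (Σᶠ-cong (λ u → sym (Σᶠ-*ˡ (f u) g)))

Σᶠ-mono : ∀ {n} {f g : Fin n → ℕ} → (∀ i → f i ≤ g i) → Σᶠ f ≤ Σᶠ g
Σᶠ-mono {zero}  f≤g = z≤n
Σᶠ-mono {suc n} f≤g = +-mono-≤ (f≤g zero) (Σᶠ-mono (λ i → f≤g (suc i)))

term≤Σᶠ : ∀ {n} (f : Fin n → ℕ) i → f i ≤ Σᶠ f
term≤Σᶠ f zero    = m≤m+n (f zero) _
term≤Σᶠ f (suc i) = ≤-trans (term≤Σᶠ (λ j → f (suc j)) i) (m≤n+m _ (f zero))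

Σ² : ∀ {n} → (Fin n → Fin n → ℕ) → ℕ
Σ² h = Σᶠ λ i → Σᶠ λ j → h i j

Σ³ : ∀ {n} → (Fin n → Fin n → Fin n → ℕ) → ℕ
Σ³ h = Σᶠ λ i → Σᶠ λ j → Σᶠ λ k → h i j k

Σ²-cong : ∀ {n} {h h′ : Fin n → Fin n → ℕ} → (∀ i j → h i j ≡ h′ i j) → Σ² h ≡ Σ² h′
Σ²-cong h≗h′ = Σᶠ-cong (λ i → Σᶠ-cong (h≗h′ i))

Σ³-cong : ∀ {n} {h h′ : Fin n → Fin n → Fin n → ℕ} → (∀ i j k → h i j k ≡ h′ i j k) → Σ³ h ≡ Σ³ h′
Σ³-cong h≗h′ = Σᶠ-cong (λ i → Σ²-cong (h≗h′ i))

Σ³-mono : ∀ {n} {h h′ : Fin n → Fin n → Fin n → ℕ} → (∀ i j k → h i j k ≤ h′ i j k) → Σ³ h ≤ Σ³ h′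
Σ³-mono h≤h′ = Σᶠ-mono (λ i → Σᶠ-mono (λ j → Σᶠ-mono (h≤h′ i j)))

Σ²-+ : ∀ {n} (h h′ : Fin n → Fin n → ℕ) → Σ² (λ i j → h i j + h′ i j) ≡ Σ² h + Σ² h′
Σ²-+ h h′ = trans (Σᶠ-cong (λ i → Σᶠ-+ (h i) (h′ i))) (Σᶠ-+ (λ i → Σᶠ (h i)) (λ i → Σᶠ (h′ i)))

Σ³-+ : ∀ {n} (h h′ : Fin n → Fin n → Fin n → ℕ) → Σ³ (λ i j k → h i j k + h′ i j k) ≡ Σ³ h + Σ³ h′
Σ³-+ h h′ = trans (Σᶠ-cong (λ i → Σ²-+ (h i) (h′ i))) (Σᶠ-+ (λ i → Σ² (h i)) (λ i → Σ² (h′ i)))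

Σ³-swap₁₂ : ∀ {n} (h : Fin n → Fin n → Fin n → ℕ) → Σ³ h ≡ Σ³ (λ i j k → h j i k)
Σ³-swap₁₂ h = Σᶠ-comm (λ i j → Σᶠ (h i j))

Σ³-swap₂₃ : ∀ {n} (h : Fin n → Fin n → Fin n → ℕ) → Σ³ h ≡ Σ³ (λ i j k → h i k j)
Σ³-swap₂₃ h = Σᶠ-cong (λ i → Σᶠ-comm (h i))

𝟙-∧ : ∀ a b → 𝟙 (a ∧ b) ≡ 𝟙 a * 𝟙 b
𝟙-∧ true  b = sym (+-identityʳ (𝟙 b))
𝟙-∧ false b = refl

𝟙-*-mono : ∀ b {x y} → (b ≡ true → x ≤ y) → 𝟙 b * x ≤ 𝟙 b * y
𝟙-*-mono true  x≤y = *-monoʳ-≤ 1 (x≤y refl)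
𝟙-*-mono false x≤y = z≤n

𝟙-*-split : ∀ b x → 𝟙 b * x + 𝟙 (not b) * x ≡ x
𝟙-*-split true  x = trans (+-identityʳ _) (+-identityʳ x)
𝟙-*-split false x = +-identityʳ x

Σᶠ-split : ∀ {n} (p : Fin n → Bool) (f : Fin n → ℕ) →
  Σᶠ (λ i → 𝟙 (p i) * f i) + Σᶠ (λ i → 𝟙 (not (p i)) * f i) ≡ Σᶠ f
Σᶠ-split p f = trans (sym (Σᶠ-+ (λ i → 𝟙 (p i) * f i) (λ i → 𝟙 (not (p i)) * f i)))
                     (Σᶠ-cong (λ i → 𝟙-*-split (p i) (f i)))

count : ∀ {n} → (Fin n → Bool) → ℕ
count p = Σᶠ λ i → 𝟙 (p i)

count-all : ∀ n → count {n} (λ _ → true) ≡ n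
count-all zero    = refl
count-all (suc n) = cong suc (count-all n)

count-∧-< : ∀ {n} (p q : Fin n → Bool) x → p x ≡ true → q x ≡ false →
  count (λ i → p i ∧ q i) < count p
count-∧-< {n} p q x px qx = begin-strict
  count p∧q                                                          <⟨ +-monoˡ-≤ (count p∧q) x∈p∧¬q ⟩
  count p∧¬q + count p∧q                                             ≡⟨ +-comm (count p∧¬q) (count p∧q) ⟩
  count p∧q + count p∧¬q                                             ≡⟨ cong₂ _+_ (count-∧ q) (count-∧ (λ i → not (q i))) ⟩
  Σᶠ (λ i → 𝟙 (q i) * 𝟙 (p i)) + Σᶠ (λ i → 𝟙 (not (q i)) * 𝟙 (p i)) ≡⟨ Σᶠ-split q (λ i → 𝟙 (p i)) ⟩
  count p                                                            ∎
  where
  open ≤-Reasoning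
  p∧q p∧¬q : Fin n → Bool
  p∧q  i = p i ∧ q i
  p∧¬q i = p i ∧ not (q i)
  count-∧ : ∀ r → count (λ i → p i ∧ r i) ≡ Σᶠ (λ i → 𝟙 (r i) * 𝟙 (p i))
  count-∧ r = Σᶠ-cong (λ i → trans (𝟙-∧ (p i) (r i)) (*-comm (𝟙 (p i)) (𝟙 (r i))))
  x∈p∧¬q : 1 ≤ count p∧¬q
  x∈p∧¬q = ≤-trans (≤-reflexive (cong₂ (λ a b → 𝟙 (a ∧ not b)) (sym px) (sym qx))) (term≤Σᶠ _ x)

<ᶠ-trichotomy : ∀ {n} (i j : Fin n) → 𝟙 (i <ᶠ j) + 𝟙 (j <ᶠ i) ≡ 1 ⊎ i ≡ j
<ᶠ-trichotomy zero    zero    = inj₂ refl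
<ᶠ-trichotomy zero    (suc j) = inj₁ refl
<ᶠ-trichotomy (suc i) zero    = inj₁ refl
<ᶠ-trichotomy (suc i) (suc j) = map₂ (cong suc) (<ᶠ-trichotomy i j)

Σ²-ordered : ∀ {n} (g : Fin n → Fin n → ℕ) → (∀ i j → g i j ≡ g j i) → (∀ i → g i i ≡ 0) →
  Σ² g ≡ 2 * Σ² (λ i j → 𝟙 (i <ᶠ j) * g i j)
Σ²-ordered {n} g g-sym g-diag = begin
  Σ² g                      ≡⟨ Σ²-cong split ⟩
  Σ² (λ i j → g< i j + g> i j) ≡⟨ Σ²-+ g< g> ⟩
  Σ² g< + Σ² g>             ≡⟨ cong (Σ² g< +_) (Σᶠ-comm g>) ⟩
  Σ² g< + Σ² g<             ≡⟨ cong (Σ² g< +_) (sym (+-identityʳ _)) ⟩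
  2 * Σ² g<                 ∎
  where
  open ≡-Reasoning
  g< g> : Fin n → Fin n → ℕ
  g< i j = 𝟙 (i <ᶠ j) * g i j
  g> i j = 𝟙 (j <ᶠ i) * g j i
  split : ∀ i j → g i j ≡ g< i j + g> i j
  split i j with <ᶠ-trichotomy i j
  ... | inj₁ one = begin
    g i j                                         ≡⟨ sym (*-identityˡ (g i j)) ⟩
    1 * g i j                                     ≡⟨ cong (_* g i j) (sym one) ⟩
    (𝟙 (i <ᶠ j) + 𝟙 (j <ᶠ i)) * g i j              ≡⟨ *-distribʳ-+ (g i j) (𝟙 (i <ᶠ j)) _ ⟩
    𝟙 (i <ᶠ j) * g i j + 𝟙 (j <ᶠ i) * g i j        ≡⟨ cong (λ x → 𝟙 (i <ᶠ j) * g i j + 𝟙 (j <ᶠ i) * x) (g-sym i j) ⟩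
    𝟙 (i <ᶠ j) * g i j + 𝟙 (j <ᶠ i) * g j i        ∎
  ... | inj₂ refl rewrite g-diag i = sym (cong₂ _+_ (*-zeroʳ (𝟙 (i <ᶠ i))) (*-zeroʳ (𝟙 (i <ᶠ i))))

ordered : ∀ {n} → Fin n → Fin n → Fin n → ℕ
ordered i j k = 𝟙 (i <ᶠ j) * 𝟙 (j <ᶠ k)

orderings : ∀ {n} → Fin n → Fin n → Fin n → ℕ
orderings i j k =
  ordered i j k + ordered j i k + ordered i k j + ordered j k i + ordered k i j + ordered k j i

orderings-rotate : ∀ {n} (i j k : Fin n) → orderings i j k ≡ orderings j k i
orderings-rotate i j k = shuffle (ordered i j k) (ordered j i k) (ordered i k j)
                                 (ordered j k i) (ordered k i j) (ordered k j i)
  where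
  shuffle : ∀ a b c d e f → a + b + c + d + e + f ≡ d + f + b + e + a + c
  shuffle = solve-∀

<ᶠ-asym : ∀ {n} (i j : Fin n) → 𝟙 (i <ᶠ j) + 𝟙 (j <ᶠ i) ≤ 1
<ᶠ-asym zero    zero    = z≤n
<ᶠ-asym zero    (suc j) = ≤-refl
<ᶠ-asym (suc i) zero    = ≤-refl
<ᶠ-asym (suc i) (suc j) = <ᶠ-asym i j

orderings-zero≤1 : ∀ {n} (j k : Fin n) → orderings zero (suc j) (suc k) ≤ 1
orderings-zero≤1 j k with j <ᶠ k | k <ᶠ j | <ᶠ-asym j k
... | true  | true  | s≤s ()
... | true  | false | _ = ≤-refl
... | false | true  | _ = ≤-refl
... | false | false | _ = z≤n

orderings≤1 : ∀ {n} (i j k : Fin n) → orderings i j k ≤ 1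
orderings≤1 zero    zero    zero    = z≤n
orderings≤1 zero    zero    (suc k) = z≤n
orderings≤1 zero    (suc j) zero    = z≤n
orderings≤1 (suc i) zero    zero    = z≤n
orderings≤1 zero    (suc j) (suc k) = orderings-zero≤1 j k
orderings≤1 (suc i) zero    (suc k) =
  subst (_≤ 1) (sym (orderings-rotate (suc i) zero (suc k))) (orderings-zero≤1 k i)
orderings≤1 (suc i) (suc j) zero    =
  subst (_≤ 1) (sym (trans (orderings-rotate (suc i) (suc j) zero) (orderings-rotate (suc j) zero (suc i))))
        (orderings-zero≤1 i j)
orderings≤1 (suc i) (suc j) (suc k) = orderings≤1 i j k

-- Since g is symmetric, each of the six permutations of `ordered` has the same g-weighted
-- sum, and pointwise they add up to at most 1.
Σ³-ordered : ∀ {n} (g : Fin n → Fin n → Fin n → ℕ) →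
  (∀ i j k → g i j k ≡ g j i k) → (∀ i j k → g i j k ≡ g i k j) →
  6 * Σ³ (λ i j k → ordered i j k * g i j k) ≤ Σ³ g
Σ³-ordered {n} g g-swap₁₂ g-swap₂₃ = begin
  6 * W o                                                         ≡⟨ six-copies (W o) ⟩
  W o + W o + W o + W o + W o + W o                               ≡⟨ cong₂ _+_ (cong₂ _+_ (cong₂ _+_ (cong₂ _+_ (cong₂ _+_
                                                                       refl (W-swap₁₂ o)) (W-swap₂₃ o)) W-o₂₃₁) W-o₃₁₂) W-o₃₂₁ ⟩
  W o + W o₂₁₃ + W o₁₃₂ + W o₂₃₁ + W o₃₁₂ + W o₃₂₁               ≡⟨ W-orderings ⟨
  W orderings                                                     ≤⟨ Σ³-mono (λ i j k → *-monoˡ-≤ (g i j k) (orderings≤1 i j k)) ⟩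
  Σ³ (λ i j k → 1 * g i j k)                                      ≡⟨ Σ³-cong (λ i j k → *-identityˡ (g i j k)) ⟩
  Σ³ g                                                            ∎
  where
  open ≤-Reasoning
  infixl 6 _⊕_
  W : (Fin n → Fin n → Fin n → ℕ) → ℕ
  W h = Σ³ (λ i j k → h i j k * g i j k)
  o o₂₁₃ o₁₃₂ o₂₃₁ o₃₁₂ o₃₂₁ : Fin n → Fin n → Fin n → ℕ
  o     i j k = ordered i j k
  o₂₁₃ i j k = ordered j i k
  o₁₃₂ i j k = ordered i k j
  o₂₃₁ i j k = ordered j k i
  o₃₁₂ i j k = ordered k i j
  o₃₂₁ i j k = ordered k j i
  W-swap₁₂ : ∀ h → W h ≡ W (λ i j k → h j i k)
  W-swap₁₂ h = trans (Σ³-cong (λ i j k → cong (h i j k *_) (g-swap₁₂ i j k)))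
                     (Σ³-swap₁₂ (λ i j k → h i j k * g j i k))
  W-swap₂₃ : ∀ h → W h ≡ W (λ i j k → h i k j)
  W-swap₂₃ h = trans (Σ³-cong (λ i j k → cong (h i j k *_) (g-swap₂₃ i j k)))
                     (Σ³-swap₂₃ (λ i j k → h i j k * g i k j))
  W-o₂₃₁ : W o ≡ W o₂₃₁
  W-o₂₃₁ = trans (W-swap₂₃ o) (W-swap₁₂ o₁₃₂)
  W-o₃₁₂ : W o ≡ W o₃₁₂
  W-o₃₁₂ = trans (W-swap₁₂ o) (W-swap₂₃ o₂₁₃)
  W-o₃₂₁ : W o ≡ W o₃₂₁
  W-o₃₂₁ = trans W-o₃₁₂ (W-swap₁₂ o₃₁₂)
  _⊕_ : (h h′ : Fin n → Fin n → Fin n → ℕ) → Fin n → Fin n → Fin n → ℕ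
  (h ⊕ h′) i j k = h i j k + h′ i j k
  W-+ : ∀ h h′ → W (h ⊕ h′) ≡ W h + W h′
  W-+ h h′ = trans (Σ³-cong (λ i j k → *-distribʳ-+ (g i j k) (h i j k) (h′ i j k)))
                   (Σ³-+ (λ i j k → h i j k * g i j k) (λ i j k → h′ i j k * g i j k))
  W-orderings : W (o ⊕ o₂₁₃ ⊕ o₁₃₂ ⊕ o₂₃₁ ⊕ o₃₁₂ ⊕ o₃₂₁)
              ≡ W o + W o₂₁₃ + W o₁₃₂ + W o₂₃₁ + W o₃₁₂ + W o₃₂₁
  W-orderings =
    trans (W-+ (o ⊕ o₂₁₃ ⊕ o₁₃₂ ⊕ o₂₃₁ ⊕ o₃₁₂) o₃₂₁) (cong (_+ W o₃₂₁) (
    trans (W-+ (o ⊕ o₂₁₃ ⊕ o₁₃₂ ⊕ o₂₃₁) o₃₁₂) (cong (_+ W o₃₁₂) (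
    trans (W-+ (o ⊕ o₂₁₃ ⊕ o₁₃₂) o₂₃₁) (cong (_+ W o₂₃₁) (
    trans (W-+ (o ⊕ o₂₁₃) o₁₃₂) (cong (_+ W o₁₃₂) (
    W-+ o o₂₁₃))))))))
  six-copies : ∀ x → 6 * x ≡ x + x + x + x + x + x
  six-copies = solve-∀

≤-by-surplus : ∀ {m n} k → m + k ≡ n → m ≤ n
≤-by-surplus k refl = m≤m+n _ k

m*m≤n*n⇒m≤n : ∀ {m n} → m * m ≤ n * n → m ≤ n
m*m≤n*n⇒m≤n m²≤n² = ≮⇒≥ (λ n<m → <⇒≱ (*-mono-< n<m n<m) m²≤n²)

square-ratio-mono : ∀ c {x y} → x ≤ y → x * x * (c + y) ≤ y * y * (c + x)
square-ratio-mono c {x} x≤y with m≤n⇒∃[o]m+o≡n x≤y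
... | r , refl = ≤-by-surplus (x * x * r + 2 * x * r * c + r * r * x + r * r * c) (expand x r c)
  where
  expand : ∀ x r c → x * x * (c + (x + r)) + (x * x * r + 2 * x * r * c + r * r * x + r * r * c)
                   ≡ (x + r) * (x + r) * (c + x)
  expand = solve-∀

square-ratio-succ-mono : ∀ {e m} → e ≤ m →
  suc m * suc (suc m) * (e * e) ≤ m * m * (suc e * suc (suc e))
square-ratio-succ-mono {e} e≤m with m≤n⇒∃[o]m+o≡n e≤m
... | k , refl = ≤-by-surplus (k * (3 * e * e + 3 * e * k + 4 * e + 2 * k)) (expand e k)
  where
  expand : ∀ e k → suc (e + k) * suc (suc (e + k)) * (e * e) + k * (3 * e * e + 3 * e * k + 4 * e + 2 * k)
                 ≡ (e + k) * (e + k) * (suc e * suc (suc e))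
  expand = solve-∀

vertex-bound : ∀ {m d P F} → d < suc (suc m) → d + P ≤ d * d → 2 * d + P ≤ F →
  suc m * suc (suc m) * (P * P) ≤ m * m * F * (d * d)
vertex-bound {m} {zero} _ P≤0 _ rewrite n≤0⇒n≡0 P≤0 | *-zeroʳ (suc m * suc (suc m)) = z≤n
-- Both sides are multiplied by 2d + p = d (d + 1), where p = d (d - 1) is the largest possible P.
vertex-bound {m} {suc e} {P} {F} (s≤s (s≤s e≤m)) d+P≤d² 2d+P≤F =
  *-cancelʳ-≤ _ _ (2 * d + p) (begin
    K * (P * P) * (2 * d + p)           ≡⟨ *-assoc K (P * P) (2 * d + p) ⟩
    K * (P * P * (2 * d + p))           ≤⟨ *-monoʳ-≤ K (square-ratio-mono (2 * d) P≤p) ⟩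
    K * (p * p * (2 * d + P))           ≤⟨ *-monoʳ-≤ K (*-monoʳ-≤ (p * p) 2d+P≤F) ⟩
    K * (p * p * F)                     ≡⟨ regroup K d e F ⟩
    K * (e * e) * (d * d * F)           ≤⟨ *-monoˡ-≤ (d * d * F) (square-ratio-succ-mono e≤m) ⟩
    m * m * (d * suc d) * (d * d * F)   ≡⟨ regroup′ (m * m) e F ⟩
    m * m * F * (d * d) * (2 * d + p)   ∎)
  where
  open ≤-Reasoning
  K d p : ℕ
  K = suc m * suc (suc m)
  d = suc e
  p = d * e
  P≤p : P ≤ p
  P≤p = +-cancelˡ-≤ d P p (subst (d + P ≤_) (*-suc d e) d+P≤d²)
  regroup : ∀ K d e F → K * (d * e * (d * e) * F) ≡ K * (e * e) * (d * d * F)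
  regroup = solve-∀
  regroup′ : ∀ M e F → M * (suc e * suc (suc e)) * (suc e * suc e * F)
                     ≡ M * F * (suc e * suc e) * (2 * suc e + suc e * e)
  regroup′ = solve-∀

cross-term-≤ : ∀ K M {x y x′ y′} → K * (x * x) ≤ M * (y * y) → K * (x′ * x′) ≤ M * (y′ * y′) →
  K * (x * x′) ≤ M * (y * y′)
cross-term-≤ K M {x} {y} {x′} {y′} hx hx′ = m*m≤n*n⇒m≤n (begin
  K * (x * x′) * (K * (x * x′))   ≡⟨ solve (K ∷ x ∷ x′ ∷ []) ⟩
  K * (x * x) * (K * (x′ * x′))   ≤⟨ *-mono-≤ hx hx′ ⟩
  M * (y * y) * (M * (y′ * y′))   ≡⟨ solve (M ∷ y ∷ y′ ∷ []) ⟩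
  M * (y * y′) * (M * (y * y′))   ∎)
  where open ≤-Reasoning

*-Σᶠ-square : ∀ {n} c (f : Fin n → ℕ) → c * (Σᶠ f * Σᶠ f) ≡ Σ² (λ u v → c * (f u * f v))
*-Σᶠ-square c f = trans (cong (c *_) (Σᶠ-*-Σᶠ f f))
  (trans (sym (Σᶠ-*ˡ c (λ u → Σᶠ (λ v → f u * f v))))
         (Σᶠ-cong (λ u → sym (Σᶠ-*ˡ c (λ v → f u * f v)))))

Σᶠ-square-≤ : ∀ {n} K M (x y : Fin n → ℕ) → (∀ u → K * (x u * x u) ≤ M * (y u * y u)) →
  K * (Σᶠ x * Σᶠ x) ≤ M * (Σᶠ y * Σᶠ y)
Σᶠ-square-≤ K M x y h = begin
  K * (Σᶠ x * Σᶠ x)                 ≡⟨ *-Σᶠ-square K x ⟩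
  Σ² (λ u v → K * (x u * x v))      ≤⟨ Σᶠ-mono (λ u → Σᶠ-mono (λ v →
                                         cross-term-≤ K M {x u} {y u} {x v} {y v} (h u) (h v))) ⟩
  Σ² (λ u v → M * (y u * y v))      ≡⟨ *-Σᶠ-square M y ⟨
  M * (Σᶠ y * Σᶠ y)                 ∎
  where open ≤-Reasoning

module _ {n} (G : SimpleGraph n) where

  degree : Fin n → ℕ
  degree v = count (Adj G v)

  codegree : Fin n → Fin n → ℕ
  codegree u v = count (λ k → Adj G u k ∧ Adj G v k)

  isTriangle : Fin n → Fin n → Fin n → Bool
  isTriangle i j k = Adj G i j ∧ Adj G j k ∧ Adj G i k

  closedWalks₃ : Fin n → ℕ
  closedWalks₃ v = Σ² λ j k → 𝟙 (isTriangle v j k)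

  handshake : Σᶠ degree ≡ 2 * edgeCount G
  handshake = trans (Σ²-ordered adj (λ i j → cong 𝟙 (symmetric G i j)) (λ i → cong 𝟙 (loopless G i)))
                    (cong (2 *_) (Σ²-cong (λ i j → sym (𝟙-∧ (i <ᶠ j) (Adj G i j)))))
    where
    adj : Fin n → Fin n → ℕ
    adj i j = 𝟙 (Adj G i j)

  degree<n : ∀ v → degree v < n
  degree<n v = subst (degree v <_) (count-all n) (count-∧-< (λ _ → true) (Adj G v) v refl (loopless G v))

  closedWalks₃-codegree : ∀ v → closedWalks₃ v ≡ Σᶠ λ j → 𝟙 (Adj G v j) * codegree j v
  closedWalks₃-codegree v = Σᶠ-cong λ j →
    trans (Σᶠ-cong (λ k → 𝟙-∧ (Adj G v j) (Adj G j k ∧ Adj G v k)))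
          (Σᶠ-*ˡ (𝟙 (Adj G v j)) (λ k → 𝟙 (Adj G j k ∧ Adj G v k)))

  degree+closedWalks₃≤Σneighbours : ∀ v (w : Fin n → ℕ) → (∀ j → Adj G v j ≡ true → codegree j v < w j) →
    degree v + closedWalks₃ v ≤ Σᶠ λ j → 𝟙 (Adj G v j) * w j
  degree+closedWalks₃≤Σneighbours v w codegree<w = begin
    degree v + closedWalks₃ v                              ≡⟨ cong (degree v +_) (closedWalks₃-codegree v) ⟩
    Σᶠ (λ j → 𝟙 (Adj G v j)) + Σᶠ (λ j → 𝟙 (Adj G v j) * codegree j v)
                                                           ≡⟨ Σᶠ-+ (λ j → 𝟙 (Adj G v j)) (λ j → 𝟙 (Adj G v j) * codegree j v) ⟨
    Σᶠ (λ j → 𝟙 (Adj G v j) + 𝟙 (Adj G v j) * codegree j v) ≡⟨ Σᶠ-cong (λ j → *-suc (𝟙 (Adj G v j)) (codegree j v)) ⟨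
    Σᶠ (λ j → 𝟙 (Adj G v j) * suc (codegree j v))          ≤⟨ Σᶠ-mono (λ j → 𝟙-*-mono (Adj G v j) (codegree<w j)) ⟩
    Σᶠ (λ j → 𝟙 (Adj G v j) * w j)                         ∎
    where open ≤-Reasoning

  degree+closedWalks₃≤degree*degree : ∀ v → degree v + closedWalks₃ v ≤ degree v * degree v
  degree+closedWalks₃≤degree*degree v = ≤-trans (degree+closedWalks₃≤Σneighbours v (λ _ → degree v) codegree<degree)
                                           (≤-reflexive (Σᶠ-*ʳ (degree v) (λ j → 𝟙 (Adj G v j))))
    where
    codegree<degree : ∀ j → Adj G v j ≡ true → codegree j v < degree v
    codegree<degree j vj = subst (_< degree v) (Σᶠ-cong (λ k → cong 𝟙 (∧-comm (Adj G v k) (Adj G j k))))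
                                 (count-∧-< (Adj G v) (Adj G j) j vj (loopless G j))

  2*degree+closedWalks₃≤2*edgeCount : ∀ v → 2 * degree v + closedWalks₃ v ≤ 2 * edgeCount G
  2*degree+closedWalks₃≤2*edgeCount v = begin
    2 * degree v + closedWalks₃ v                ≡⟨ regroup (degree v) (closedWalks₃ v) ⟩
    degree v + closedWalks₃ v + degree v         ≤⟨ +-mono-≤ (degree+closedWalks₃≤Σneighbours v degree codegree<degree) v-term ⟩
    Σᶠ (λ j → 𝟙 (Adj G v j) * degree j) + Σᶠ (λ j → 𝟙 (not (Adj G v j)) * degree j)
                                                 ≡⟨ Σᶠ-split (Adj G v) degree ⟩
    Σᶠ degree                                    ≡⟨ handshake ⟩
    2 * edgeCount G                              ∎
    where
    open ≤-Reasoning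
    regroup : ∀ d P → 2 * d + P ≡ d + P + d
    regroup = solve-∀
    codegree<degree : ∀ j → Adj G v j ≡ true → codegree j v < degree j
    codegree<degree j vj = count-∧-< (Adj G j) (Adj G v) v (trans (symmetric G j v) vj) (loopless G v)
    v-term : degree v ≤ Σᶠ (λ j → 𝟙 (not (Adj G v j)) * degree j)
    v-term = ≤-trans (≤-reflexive (sym (trans (cong (λ b → 𝟙 (not b) * degree v) (loopless G v))
                                              (*-identityˡ (degree v)))))
                     (term≤Σᶠ (λ j → 𝟙 (not (Adj G v j)) * degree j) v)

  isTriangle-swap₁₂ : ∀ i j k → isTriangle i j k ≡ isTriangle j i k
  isTriangle-swap₁₂ i j k = cong₂ _∧_ (symmetric G i j) (∧-comm (Adj G j k) (Adj G i k))

  isTriangle-swap₂₃ : ∀ i j k → isTriangle i j k ≡ isTriangle i k j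
  isTriangle-swap₂₃ i j k = begin
    Adj G i j ∧ (Adj G j k ∧ Adj G i k)   ≡⟨ ∧-comm (Adj G i j) _ ⟩
    (Adj G j k ∧ Adj G i k) ∧ Adj G i j   ≡⟨ cong (_∧ Adj G i j) (∧-comm (Adj G j k) (Adj G i k)) ⟩
    (Adj G i k ∧ Adj G j k) ∧ Adj G i j   ≡⟨ ∧-assoc (Adj G i k) (Adj G j k) (Adj G i j) ⟩
    Adj G i k ∧ (Adj G j k ∧ Adj G i j)   ≡⟨ cong (λ b → Adj G i k ∧ (b ∧ Adj G i j)) (symmetric G j k) ⟩
    Adj G i k ∧ (Adj G k j ∧ Adj G i j)   ∎
    where open ≡-Reasoning

  6*triangleCount≤ΣclosedWalks₃ : 6 * triangleCount G ≤ Σᶠ closedWalks₃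
  6*triangleCount≤ΣclosedWalks₃ = begin
    6 * triangleCount G                                        ≡⟨ cong (6 *_) (Σ³-cong 𝟙-∧³) ⟩
    6 * Σ³ (λ i j k → ordered i j k * 𝟙 (isTriangle i j k))    ≤⟨ Σ³-ordered (λ i j k → 𝟙 (isTriangle i j k))
                                                                   (λ i j k → cong 𝟙 (isTriangle-swap₁₂ i j k))
                                                                   (λ i j k → cong 𝟙 (isTriangle-swap₂₃ i j k)) ⟩
    Σᶠ closedWalks₃                                            ∎
    where
    open ≤-Reasoning
    𝟙-∧³ : ∀ i j k → 𝟙 ((i <ᶠ j) ∧ (j <ᶠ k) ∧ isTriangle i j k) ≡ ordered i j k * 𝟙 (isTriangle i j k)
    𝟙-∧³ i j k = trans (𝟙-∧ (i <ᶠ j) _) (trans (cong (𝟙 (i <ᶠ j) *_) (𝟙-∧ (j <ᶠ k) (isTriangle i j k)))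
                                              (sym (*-assoc (𝟙 (i <ᶠ j)) (𝟙 (j <ᶠ k)) _)))

mainTheorem5 : (V : ℕ) → 2 ≤ V → (G : SimpleGraph V) →
    9 * V * (V ∸ 1) * triangleCount G ^ 2 ≤ 2 * (V ∸ 2) ^ 2 * edgeCount G ^ 3
mainTheorem5 (suc (suc m)) (s≤s (s≤s z≤n)) G =
  *-cancelˡ-≤ 4 (subst₂ _≤_ (expand-lhs m T) (expand-rhs m E) (begin
    K * (6 * T * (6 * T))                  ≤⟨ *-monoʳ-≤ K (*-mono-≤ 6T≤ΣP 6T≤ΣP) ⟩
    K * (Σᶠ P * Σᶠ P)                      ≤⟨ Σᶠ-square-≤ K (m * m * (2 * E)) P (degree G) per-vertex ⟩
    m * m * (2 * E) * (Σᶠ (degree G) * Σᶠ (degree G))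
                                           ≡⟨ cong (λ s → m * m * (2 * E) * (s * s)) (handshake G) ⟩
    m * m * (2 * E) * (2 * E * (2 * E))    ∎))
  where
  open ≤-Reasoning
  T E K : ℕ
  T = triangleCount G
  E = edgeCount G
  K = suc m * suc (suc m)
  P : Fin (suc (suc m)) → ℕ
  P = closedWalks₃ G
  6T≤ΣP : 6 * T ≤ Σᶠ P
  6T≤ΣP = 6*triangleCount≤ΣclosedWalks₃ G
  per-vertex : ∀ v → K * (P v * P v) ≤ m * m * (2 * E) * (degree G v * degree G v)
  per-vertex v = vertex-bound (degree<n G v) (degree+closedWalks₃≤degree*degree G v)
                              (2*degree+closedWalks₃≤2*edgeCount G v)
  -- x ^ 2 is written x * (x * 1), its unfolding, because solve-∀ rejects _^_.
  expand-lhs : ∀ x t → suc x * suc (suc x) * (6 * t * (6 * t))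
                     ≡ 4 * (9 * suc (suc x) * suc x * (t * (t * 1)))
  expand-lhs = solve-∀
  expand-rhs : ∀ x e → x * x * (2 * e) * (2 * e * (2 * e))
                     ≡ 4 * (2 * (x * (x * 1)) * (e * (e * (e * 1))))
  expand-rhs = solve-∀
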